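{- Let $\Delta_2>\Delta_1\ge1$ be integers. A temporal graph $\mathcal G$ is a $(\Delta_1,\Delta_2)$-cluster temporal graph if and only if every $\Delta_2$-saturated (in $\mathcal G$) set of time-edges of $\mathcal G$ forms a $\Delta_1$-temporal clique.
   Context: A temporal graph $\mathcal G=(G,\mathcal T)$ consists of a finite static undirected graph $G=(V,E)$ and a function $\mathcal T:E\to 2^{\mathbb Z^+}\setminus\{\emptyset\}$ (finite sets); its time-edges are $\mathcal E(\mathcal G)=\{(e,t):e\in E,\ t\in\mathcal T(e)\}$ and its lifetime is $T(\mathcal G)=\max\{t:(e,t)\in\mathcal E(\mathcal G)\}$. An interval $[a,b]$ means $\{a,\dots,b\}\subseteq\mathbb Z$. An edge $e$ is $\Delta_1$-dense in $[a,b]$ if for every $\tau\in[a,\max\{a,b-\Delta_1+1\}]$ there is $t\in\mathcal T(e)$ with $\tau\le t\le\tau+\Delta_1-1$. For a set $S$ of time-edges, $V(S)$ is the set of endpoints of its time-edges and $L(S)=[\min\{t:(e,t)\in S\},\max\{t:(e,t)\in S\}]$; $S$ generates the template $(V(S),L(S))$. A set $S$ of time-edges forms a $\Delta_1$-temporal clique if for every pair of distinct $x,y\in V(S)$ the edge $xy$ is $\Delta_1$-dense in $L(S)$. Templates $(X,[a,b])$, $(Y,[c,d])$ are $\Delta_2$-independent if $X\cap Y=\emptyset$ or $|s-t|\ge\Delta_2$ for all $s\in[a,b]$, $t\in[c,d]$; two sets of time-edges are $\Delta_2$-independent if the templates they generate are. A set of time-edges is $\Delta_2$-indivisible if it cannot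 be written as the union of at least two nonempty, pairwise $\Delta_2$-independent sets of time-edges; a $\Delta_2$-indivisible $S\subseteq\mathcal E(\mathcal G)$ is $\Delta_2$-saturated in $\mathcal G$ if adding any other time-edge of $\mathcal E(\mathcal G)$ yields a set that is not $\Delta_2$-indivisible. $\mathcal G$ realises a collection $\{(X_i,[a_i,b_i])\}_i$ of pairwise $\Delta_2$-independent templates with $1\le a_i\le b_i\le T(\mathcal G)$ if every time-edge $(xy,t)$ has some $i$ with $x,y\in X_i$, $t\in[a_i,b_i]$, and for every $i$ and distinct $x,y\in X_i$, $xy$ is an edge that is $\Delta_1$-dense in $[a_i,b_i]$; $\mathcal G$ is a $(\Delta_1,\Delta_2)$-cluster temporal graph if it realises some such collection. -}

module Defs where

open import Data.Nat using (ℕ; zero; suc; _+_; _∸_; _≤_; _<_; _⊔_; ∣_-_∣)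
open import Data.Bool using (Bool; true; false)
open import Data.Fin as F using (Fin)
open import Data.Fin.Subset using (Subset; _∈_)
open import Data.Product using (Σ; ∃; _×_; _,_; ∃-syntax)
open import Data.Sum using (_⊎_)
open import Data.Empty using (⊥)
open import Relation.Nullary using (¬_)
open import Relation.Binary.PropositionalEquality using (_≡_; _≢_)
open import Level using (Level)

-- Temporal graphs on the vertex set Fin n.
-- 'at x y t ≡ true' means: xy is an edge of G and t ∈ 𝒯(xy).
-- The static edge set E is {xy : ∃ t, at x y t ≡ true}, so every
-- edge automatically has a nonempty label set; labels are positive
-- integers and the set of all labels is finite (bounded).

record TGraph (n : ℕ) : Set where
  field
    at      : Fin n → Fin n → ℕ → Bool
    sym     : ∀ x y t → at x y t ≡ at y x t
    irrefl  : ∀ x t → at x x t ≡ false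
    pos     : ∀ x y → at x y 0 ≡ false
    bounded : ∃[ L ] (∀ x y t → L < t → at x y t ≡ false)
open TGraph public

-- A time-edge (xy, t) is represented canonically as (x , y , t) with x < y.
TimeEdge : ℕ → Set
TimeEdge n = Fin n × Fin n × ℕ

IsTE : ∀ {n} → TGraph n → TimeEdge n → Set
IsTE G (x , y , t) = (x F.< y) × (at G x y t ≡ true)

TESet : ℕ → Set₁
TESet n = TimeEdge n → Set

time : ∀ {n} → TimeEdge n → ℕ
time (_ , _ , t) = t

VS : ∀ {n} → TESet n → Fin n → Set
VS S v = ∃[ e ] (S e × (v ≡ Data.Product.proj₁ e ⊎ v ≡ Data.Product.proj₁ (Data.Product.proj₂ e)))

Span : ∀ {n} → TESet n → ℕ → ℕ → Set
Span S a b =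
  (∃[ e ] (S e × time e ≡ a)) × (∃[ e ] (S e × time e ≡ b)) ×
  (∀ e → S e → a ≤ time e × time e ≤ b)

Nonempty : ∀ {n} → TESet n → Set
Nonempty S = ∃[ e ] S e

Dense : ∀ {n} → TGraph n → ℕ → Fin n → Fin n → ℕ → ℕ → Set
Dense G Δ₁ x y a b =
  ∀ τ → a ≤ τ → τ ≤ a ⊔ (b + 1 ∸ Δ₁) →
  ∃[ t ] (τ ≤ t × t ≤ τ + Δ₁ ∸ 1 × at G x y t ≡ true)

Clique : ∀ {n} → TGraph n → ℕ → TESet n → Set
Clique G Δ₁ S = ∀ a b → Span S a b →
  ∀ x y → x ≢ y → VS S x → VS S y → Dense G Δ₁ x y a b

TemplIndep : ∀ {n} → ℕ → (Fin n → Set) → ℕ → ℕ → (Fin n → Set) → ℕ → ℕ → Set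
TemplIndep Δ₂ X a b Y c d =
  (∀ v → X v → Y v → ⊥) ⊎
  (∀ s t → a ≤ s → s ≤ b → c ≤ t → t ≤ d → Δ₂ ≤ ∣ s - t ∣)

Indep : ∀ {n} → ℕ → TESet n → TESet n → Set
Indep Δ₂ A B = ∀ a b c d → Span A a b → Span B c d →
  TemplIndep Δ₂ (VS A) a b (VS B) c d

Indivisible : ∀ {n} → ℕ → TESet n → Set₁
Indivisible {n} Δ₂ S = ¬ (Σ ℕ λ k → 2 ≤ k × Σ (Fin k → TESet n) λ P →
  (∀ i → Nonempty (P i)) ×
  (∀ i j → i ≢ j → Indep Δ₂ (P i) (P j)) ×
  (∀ e → (S e → ∃[ i ] P i e) × (∀ i → P i e → S e)))

_∪｛_｝ : ∀ {n} → TESet n → TimeEdge n → TESet n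
(S ∪｛ e ｝) f = S f ⊎ f ≡ e

Saturated : ∀ {n} → TGraph n → ℕ → TESet n → Set₁
Saturated G Δ₂ S =
  (∀ e → S e → IsTE G e) × Indivisible Δ₂ S ×
  (∀ e → IsTE G e → ¬ S e → ¬ Indivisible Δ₂ (S ∪｛ e ｝))

IsLifetime : ∀ {n} → TGraph n → ℕ → Set
IsLifetime G L = (∃[ x ] ∃[ y ] (at G x y L ≡ true)) ×
  (∀ x y t → at G x y t ≡ true → t ≤ L)

Realises : ∀ {n} → TGraph n → ℕ → ℕ → (k : ℕ) →
  (Fin k → Subset n) → (Fin k → ℕ) → (Fin k → ℕ) → Set
Realises G Δ₁ Δ₂ k X a b =
  (∀ i j → i ≢ j → TemplIndep Δ₂ (λ v → v ∈ X i) (a i) (b i) (λ v → v ∈ X j) (a j) (b j)) ×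
  (∀ i → 1 ≤ a i × a i ≤ b i × (∀ L → IsLifetime G L → b i ≤ L)) ×
  (∀ x y t → at G x y t ≡ true → ∃[ i ] (x ∈ X i × y ∈ X i × a i ≤ t × t ≤ b i)) ×
  (∀ i x y → x ≢ y → x ∈ X i → y ∈ X i → Dense G Δ₁ x y (a i) (b i))

Cluster : ∀ {n} → TGraph n → ℕ → ℕ → Set
Cluster {n} G Δ₁ Δ₂ = Σ ℕ λ k → Σ (Fin k → Subset n) λ X →
  Σ (Fin k → ℕ) λ a → Σ (Fin k → ℕ) λ b → Realises G Δ₁ Δ₂ k X a b

-- If 𝒢 realises a collection of templates, the time-edges lying in each template form a family of
-- pairwise Δ₂-independent sets covering ℰ(𝒢), and an indivisible set lies inside a single member of
-- any such family. A saturated set S therefore lives in one template (X , [a , b]), and the density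
-- of that template gives every clique window of S, except possibly the one starting at min L(S) when
-- the last full window μ = max(a , b - Δ₁ + 1) of the template starts earlier. That window is handled
-- by saturation: xy has a label in [μ , μ + Δ₁ - 1], within Δ₁ < Δ₂ of a time-edge of S at x, so the
-- time-edge is in S and its label is at least min L(S).
-- Conversely, start from the singletons of ℰ(𝒢) and merge two classes as long as some two are not
-- Δ₂-independent; the union of two dependent indivisible sets is indivisible, since both lie in
-- single pieces of any independent cover and these pieces must coincide. The final classes are
-- pairwise independent, hence saturated, hence cliques by hypothesis, and their templates realise 𝒢.
-- Membership in an arbitrary set of time-edges is not decidable; as all sets involved are finite,
-- case distinctions are made under double negation, where every goal is ⊥ or decidable.
module Submission where

open import Defs hiding (sym)
open import Level using (0ℓ)
open import Data.Nat using (ℕ; zero; suc; _+_; _∸_; _≤_; _<_; _⊔_; ∣_-_∣; z≤n; s≤s; _≤?_; _<?_)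
open import Data.Nat.Properties
open import Data.Bool using (true) renaming (_≟_ to _≟ᵇ_)
open import Data.Fin as F using (Fin; toℕ; fromℕ<)
open import Data.Fin.Properties using (any?; all?; ∀-cons; toℕ<n; toℕ-fromℕ<)
  renaming (suc-injective to Fin-suc-injective; <-cmp to Fin-<-cmp)
open import Data.Fin.Subset using (Subset) renaming (_∈_ to _∈ˢ_)
open import Data.Vec using (tabulate)
open import Data.Vec.Properties using (lookup∘tabulate; []=⇒lookup; lookup⇒[]=)
open import Data.Product using (Σ; ∃; ∃₂; _×_; _,_; ∃-syntax; proj₁; proj₂)
open import Data.Sum using (_⊎_; inj₁; inj₂; [_,_]′)
open import Data.Empty using (⊥; ⊥-elim)
open import Data.List
  using (List; []; _∷_; [_]; _++_; length; map; lookup; filter; cartesianProduct; allFin; upTo)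
open import Data.List.Membership.Propositional using (_∈_; find; lose)
open import Data.List.Membership.Propositional.Properties
  using (∈-lookup; ∈-++⁺ˡ; ∈-++⁺ʳ; ∈-++⁻; ∈-map⁺; ∈-map⁻; ∈-filter⁺; ∈-filter⁻
        ; ∈-cartesianProduct⁺; ∈-allFin; ∈-upTo⁺)
open import Data.List.Relation.Unary.Any as Any using (here; there)
open import Data.List.Relation.Unary.Any.Properties using (lookup-index)
import Data.List.Relation.Unary.All as All
open import Data.List.Relation.Unary.All using (All; []; _∷_)
open import Data.List.Relation.Unary.AllPairs using (AllPairs; []; _∷_)
open import Data.List.Relation.Binary.Permutation.Propositional
  using (_↭_; ↭-refl; ↭-sym; ↭-trans; ↭-prep; ↭-swap)
open import Data.List.Relation.Binary.Permutation.Propositional.Properties using (↭-length; ∈-resp-↭)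
open import Data.List.Extrema.Nat
  using (argmin; argmax; argmin-sel; argmax-sel
        ; f[argmin]≤f[⊤]; f[argmin]≤f[xs]; f[⊥]≤f[argmax]; f[xs]≤f[argmax])
open import Effect.Monad using (RawMonad)
open import Function using (_∘_; id; _⇔_; mk⇔)
open import Function.Definitions using (Injective)
open import Relation.Binary.Definitions using (tri<; tri≈; tri>)
open import Relation.Nullary using (¬_; Dec; yes; no; does; contradiction)
open import Relation.Nullary.Negation using (¬¬-Monad; ¬¬-map)
open import Relation.Nullary.Decidable
  using (¬¬-excluded-middle; decidable-stable; dec-true; map′; _→-dec_; _×-dec_; _⊎-dec_; ¬?)
open import Relation.Unary using (Decidable; _⊆_; _∩_; _∪_)
open import Relation.Binary.PropositionalEquality using (_≡_; _≢_; refl; sym; trans; cong; subst)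

open RawMonad (¬¬-Monad {0ℓ}) using (pure; _>>=_)

¬¬-∀-Fin : ∀ {k} {P : Fin k → Set} → (∀ j → ¬ ¬ P j) → ¬ ¬ (∀ j → P j)
¬¬-∀-Fin {zero} _ = pure λ ()
¬¬-∀-Fin {suc k} ¬¬P = do
  p₀ ← ¬¬P F.zero
  ps ← ¬¬-∀-Fin (¬¬P ∘ F.suc)
  pure (∀-cons p₀ ps)

_enumerates_ : {A : Set} → List A → (A → Set) → Set
ys enumerates P = (_∈ ys) ⊆ P × P ⊆ (_∈ ys)

module _ {A : Set} (P : A → Set) where

  filter-∷ : ∀ {x xs ys} → Dec (P x) → ys enumerates (λ y → y ∈ xs × P y) →
    ∃[ zs ] zs enumerates (λ y → y ∈ x ∷ xs × P y)
  filter-∷ {ys = ys} (yes Px) (sound , complete) = _ ∷ ys ,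
    (λ { (here refl) → here refl , Px
       ; (there y∈ys) → let y∈xs , Py = sound y∈ys in there y∈xs , Py }) ,
    (λ { (here refl , _) → here refl
       ; (there y∈xs , Py) → there (complete (y∈xs , Py)) })
  filter-∷ {ys = ys} (no ¬Px) (sound , complete) = ys ,
    (λ y∈ys → let y∈xs , Py = sound y∈ys in there y∈xs , Py) ,
    (λ { (here refl , Px) → ⊥-elim (¬Px Px)
       ; (there y∈xs , Py) → complete (y∈xs , Py) })

  ¬¬-filter : (xs : List A) → ¬ ¬ (∃[ ys ] ys enumerates (λ y → y ∈ xs × P y))
  ¬¬-filter [] = pure ([] , (λ ()) , (λ { (() , _) }))
  ¬¬-filter (x ∷ xs) = do
    ys , ys≅ ← ¬¬-filter xs
    Px? ← ¬¬-excluded-middle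
    pure (filter-∷ Px? ys≅)

  ¬¬-enumerable : (xs : List A) → P ⊆ (_∈ xs) → ¬ ¬ (∃[ ys ] ys enumerates P)
  ¬¬-enumerable xs P⊆xs = ¬¬-map restrict (¬¬-filter xs)
    where
      restrict : ∃[ ys ] ys enumerates (λ y → y ∈ xs × P y) → ∃[ ys ] ys enumerates P
      restrict (ys , sound , complete) = ys , proj₂ ∘ sound , λ Py → complete (P⊆xs Py , Py)

module _ {P : ℕ → Set} (P? : Decidable P) where

  ∀≤? : ∀ hi → Dec (∀ t → t ≤ hi → P t)
  ∀≤? hi = map′
    (λ ∀P t t≤hi → subst P (toℕ-fromℕ< (s≤s t≤hi)) (∀P (fromℕ< (s≤s t≤hi))))
    (λ ∀P i → ∀P (toℕ i) (≤-pred (toℕ<n i)))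
    (all? {P = λ (i : Fin (suc hi)) → P (toℕ i)} (P? ∘ toℕ))

  ∃≤? : ∀ hi → Dec (∃[ t ] (t ≤ hi × P t))
  ∃≤? hi = map′
    (λ (i , Pi) → toℕ i , ≤-pred (toℕ<n i) , Pi)
    (λ (t , t≤hi , Pt) → fromℕ< (s≤s t≤hi) , subst P (sym (toℕ-fromℕ< (s≤s t≤hi))) Pt)
    (any? {P = λ (i : Fin (suc hi)) → P (toℕ i)} (P? ∘ toℕ))

≤⊔-<⇒≤ : ∀ {τ p q} → τ ≤ p ⊔ q → q < τ → τ ≤ p
≤⊔-<⇒≤ {τ} {p} {q} τ≤p⊔q q<τ with ⊔-sel p q
... | inj₁ p⊔q≡p = subst (τ ≤_) p⊔q≡p τ≤p⊔q
... | inj₂ p⊔q≡q = contradiction (subst (τ ≤_) p⊔q≡q τ≤p⊔q) (<⇒≱ q<τ)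

∣-∣<-window : ∀ lo u w D → lo ≤ u → u < lo + D → lo ≤ w → w < lo + D → ∣ u - w ∣ < D
∣-∣<-window zero u w D _ u<D _ w<D = ≤-<-trans (∣m-n∣≤m⊔n u w) (⊔-lub u<D w<D)
∣-∣<-window (suc lo) (suc u) (suc w) D (s≤s lo≤u) (s≤s u<) (s≤s lo≤w) (s≤s w<) =
  ∣-∣<-window lo u w D lo≤u u< lo≤w w<

<⊔∸+ : ∀ A B D → B < A ⊔ (B + 1 ∸ D) + D
<⊔∸+ A B D = begin-strict
  B                       <⟨ subst (B <_) (+-comm 1 B) ≤-refl ⟩
  B + 1                   ≤⟨ m≤n+m∸n (B + 1) D ⟩
  D + (B + 1 ∸ D)         ≤⟨ +-monoʳ-≤ D (m≤n⊔m A (B + 1 ∸ D)) ⟩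
  D + (A ⊔ (B + 1 ∸ D))   ≡⟨ +-comm D _ ⟩
  A ⊔ (B + 1 ∸ D) + D     ∎
  where open ≤-Reasoning

≤∸1⇒< : ∀ {t m} → 1 ≤ m → t ≤ m ∸ 1 → t < m
≤∸1⇒< {t} {m} 1≤m t≤m∸1 = subst (_≤ m) (+-comm t 1) (m≤o∸n⇒m+n≤o t 1≤m t≤m∸1)

other : ∀ {k} → 2 ≤ k → (j : Fin k) → ∃[ l ] l ≢ j
other {suc (suc _)} _ F.zero = F.suc F.zero , λ ()
other {suc (suc _)} _ (F.suc _) = F.zero , λ ()
other {suc zero} (s≤s ()) F.zero

record Selection {k : ℕ} (N : Fin k → Set) (m : ℕ) : Set where
  field
    enum      : Fin m → Fin k
    injective : Injective _≡_ _≡_ enum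
    sound     : ∀ i → N (enum i)
    complete  : ∀ j → N j → ∃[ i ] enum i ≡ j

select : ∀ {k} {N : Fin k → Set} → Decidable N → ∃[ m ] Selection N m
select {zero} N? = 0 , record { enum = λ () ; injective = λ { {()} } ; sound = λ () ; complete = λ () }
select {suc k} {N} N? with select (N? ∘ F.suc) | N? F.zero
... | m , s | no ¬N₀ = m , record
  { enum = F.suc ∘ enum ; injective = injective ∘ Fin-suc-injective
  ; sound = sound ; complete = complete′ }
  where
    open Selection s
    complete′ : ∀ j → N j → ∃[ i ] F.suc (enum i) ≡ j
    complete′ F.zero N₀ = ⊥-elim (¬N₀ N₀)
    complete′ (F.suc j) Nj = complete j Nj .proj₁ , cong F.suc (complete j Nj .proj₂)
... | m , s | yes N₀ = suc m , record
  { enum = enum′ ; injective = injective′ ; sound = ∀-cons N₀ sound ; complete = complete′ }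
  where
    open Selection s
    enum′ : Fin (suc m) → Fin (suc k)
    enum′ F.zero = F.zero
    enum′ (F.suc i) = F.suc (enum i)
    injective′ : Injective _≡_ _≡_ enum′
    injective′ {F.zero} {F.zero} _ = refl
    injective′ {F.suc i} {F.suc j} eq = cong F.suc (injective (Fin-suc-injective eq))
    complete′ : ∀ j → N j → ∃[ i ] enum′ i ≡ j
    complete′ F.zero _ = F.zero , refl
    complete′ (F.suc j) Nj = F.suc (complete j Nj .proj₁) , cong F.suc (complete j Nj .proj₂)

module _ {A : Set} {R : A → A → Set} (R-sym : ∀ {x y} → R x y → R y x) where

  lookup-AllPairs : ∀ {xs} → AllPairs R xs → ∀ i j → i ≢ j → R (lookup xs i) (lookup xs j)
  lookup-AllPairs (_ ∷ _) F.zero F.zero 0≢0 = ⊥-elim (0≢0 refl)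
  lookup-AllPairs {_ ∷ xs} (Rx ∷ _) F.zero (F.suc j) _ = All.lookup Rx (∈-lookup {xs = xs} j)
  lookup-AllPairs {_ ∷ xs} (Rx ∷ _) (F.suc i) F.zero _ = R-sym (All.lookup Rx (∈-lookup {xs = xs} i))
  lookup-AllPairs (_ ∷ Rxs) (F.suc i) (F.suc j) i≢j = lookup-AllPairs Rxs i j (i≢j ∘ cong F.suc)

toSubset : ∀ {n} {P : Fin n → Set} → Decidable P → Subset n
toSubset P? = tabulate (does ∘ P?)

module _ {n} {P : Fin n → Set} (P? : Decidable P) where

  ∈-toSubset⁺ : ∀ {v} → P v → v ∈ˢ toSubset P?
  ∈-toSubset⁺ {v} Pv = lookup⇒[]= v _ (trans (lookup∘tabulate _ v) (dec-true (P? v) Pv))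

  ∈-toSubset⁻ : ∀ {v} → v ∈ˢ toSubset P? → P v
  ∈-toSubset⁻ {v} v∈ with P? v | trans (sym (lookup∘tabulate (does ∘ P?) v)) ([]=⇒lookup v∈)
  ... | yes Pv | _ = Pv

Ends : ∀ {n} → Fin n → TimeEdge n → Set
Ends v e = v ≡ proj₁ e ⊎ v ≡ proj₁ (proj₂ e)

Ends? : ∀ {n} (v : Fin n) → Decidable (Ends v)
Ends? v e = v F.≟ proj₁ e ⊎-dec v F.≟ proj₁ (proj₂ e)

SpanOf : ∀ {n} → TESet n → Set
SpanOf A = Σ ℕ λ a → Σ ℕ λ b → Span A a b

module _ {n : ℕ} where

  span-bounds : ∀ {A : TESet n} {a b} → Span A a b → A ⊆ (λ e → a ≤ time e × time e ≤ b)
  span-bounds (_ , _ , bounds) = bounds _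

  Span-unique : ∀ {A : TESet n} {a b a′ b′} → Span A a b → Span A a′ b′ → a ≡ a′ × b ≡ b′
  Span-unique sp@((_ , Ae , refl) , (_ , Af , refl) , _) sp′@((_ , Ae′ , refl) , (_ , Af′ , refl) , _) =
    ≤-antisym (span-bounds sp Ae′ .proj₁) (span-bounds sp′ Ae .proj₁) ,
    ≤-antisym (span-bounds sp′ Af .proj₂) (span-bounds sp Af′ .proj₂)

  Span-≤ : ∀ {A : TESet n} {a b} → Span A a b → a ≤ b
  Span-≤ sp@((_ , Ae , refl) , _) = span-bounds sp Ae .proj₂

  span-of-enumerated : ∀ {A : TESet n} {ys} → ys enumerates A → Nonempty A → SpanOf A
  span-of-enumerated {ys = []} (_ , complete) (_ , Ae) with complete Ae
  ... | ()
  span-of-enumerated {ys = y ∷ ys} (sound , complete) _ =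
    time lo , time hi , (lo , sound lo∈ , refl) , (hi , sound hi∈ , refl) , λ _ Ae → bounds (complete Ae)
    where
      lo hi : TimeEdge n
      lo = argmin time y ys
      hi = argmax time y ys
      lo∈ : lo ∈ y ∷ ys
      lo∈ = [ here , there ]′ (argmin-sel time y ys)
      hi∈ : hi ∈ y ∷ ys
      hi∈ = [ here , there ]′ (argmax-sel time y ys)
      bounds : ∀ {e} → e ∈ y ∷ ys → time lo ≤ time e × time e ≤ time hi
      bounds (here refl) = f[argmin]≤f[⊤] {f = time} y ys , f[⊥]≤f[argmax] {f = time} y ys
      bounds (there e∈ys) = All.lookup (f[argmin]≤f[xs] {f = time} y ys) e∈ys ,
                            All.lookup (f[xs]≤f[argmax] {f = time} y ys) e∈ys

  VS-mono : ∀ {A B : TESet n} → A ⊆ B → VS A ⊆ VS B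
  VS-mono A⊆B (e , Ae , ve) = e , A⊆B Ae , ve

module Independence (Δ₂ : ℕ) {n : ℕ} where

  TemplIndep-sym : ∀ {X Y : Fin n → Set} {a b c d} →
    TemplIndep Δ₂ X a b Y c d → TemplIndep Δ₂ Y c d X a b
  TemplIndep-sym (inj₁ disjoint) = inj₁ λ v Yv Xv → disjoint v Xv Yv
  TemplIndep-sym (inj₂ far) = inj₂ λ s t c≤s s≤d a≤t t≤b →
    subst (Δ₂ ≤_) (∣-∣-comm t s) (far t s a≤t t≤b c≤s s≤d)

  TemplIndep-mono : ∀ {X Y X′ Y′ : Fin n → Set} {a b c d a′ b′ c′ d′} → X′ ⊆ X → Y′ ⊆ Y →
    a ≤ a′ → b′ ≤ b → c ≤ c′ → d′ ≤ d → TemplIndep Δ₂ X a b Y c d → TemplIndep Δ₂ X′ a′ b′ Y′ c′ d′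
  TemplIndep-mono X′⊆X Y′⊆Y _ _ _ _ (inj₁ disjoint) = inj₁ λ v X′v Y′v → disjoint v (X′⊆X X′v) (Y′⊆Y Y′v)
  TemplIndep-mono _ _ a≤a′ b′≤b c≤c′ d′≤d (inj₂ far) = inj₂ λ s t a′≤s s≤b′ c′≤t t≤d′ →
    far s t (≤-trans a≤a′ a′≤s) (≤-trans s≤b′ b′≤b) (≤-trans c≤c′ c′≤t) (≤-trans t≤d′ d′≤d)

  Indep-sym : ∀ {A B : TESet n} → Indep Δ₂ A B → Indep Δ₂ B A
  Indep-sym ind a b c d spB spA = TemplIndep-sym (ind c d a b spA spB)

  Indep-mono : ∀ {A B P Q : TESet n} {p₁ p₂ q₁ q₂} → A ⊆ P → B ⊆ Q →
    Span P p₁ p₂ → Span Q q₁ q₂ → Indep Δ₂ P Q → Indep Δ₂ A B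
  Indep-mono A⊆P B⊆Q spP spQ ind _ _ _ _
             ((_ , Ae , refl) , (_ , Af , refl) , _) ((_ , Bg , refl) , (_ , Bh , refl) , _) =
    TemplIndep-mono (VS-mono A⊆P) (VS-mono B⊆Q)
      (span-bounds spP (A⊆P Ae) .proj₁) (span-bounds spP (A⊆P Af) .proj₂)
      (span-bounds spQ (B⊆Q Bg) .proj₁) (span-bounds spQ (B⊆Q Bh) .proj₂)
      (ind _ _ _ _ spP spQ)

  Indep-via-span : ∀ {A B : TESet n} {a b c d} → Span A a b → Span B c d →
    TemplIndep Δ₂ (VS A) a b (VS B) c d → Indep Δ₂ A B
  Indep-via-span spA spB ti _ _ _ _ spA′ spB′ with Span-unique spA spA′ | Span-unique spB spB′
  ... | refl , refl | refl , refl = ti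

  Indep⇒far : ∀ {A B : TESet n} {a b c d e f v} → Indep Δ₂ A B → Span A a b → Span B c d →
    A e → B f → Ends v e → Ends v f → Δ₂ ≤ ∣ time e - time f ∣
  Indep⇒far {e = e} {f} {v} ind spA spB Ae Bf ve vf with ind _ _ _ _ spA spB
  ... | inj₁ disjoint = ⊥-elim (disjoint v (e , Ae , ve) (f , Bf , vf))
  ... | inj₂ far = far (time e) (time f) (span-bounds spA Ae .proj₁) (span-bounds spA Ae .proj₂)
                                          (span-bounds spB Bf .proj₁) (span-bounds spB Bf .proj₂)

  Indep⇒¬indivisible-∪ : ∀ {A B : TESet n} → Nonempty A → Nonempty B → Indep Δ₂ A B →
    ¬ Indivisible Δ₂ (A ∪ B)
  Indep⇒¬indivisible-∪ {A} {B} A≠∅ B≠∅ ind indiv = indiv (2 , ≤-refl , P , nonempty , P-indep , partition)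
    where
      P : Fin 2 → TESet n
      P F.zero = A
      P (F.suc F.zero) = B
      nonempty : ∀ i → Nonempty (P i)
      nonempty F.zero = A≠∅
      nonempty (F.suc F.zero) = B≠∅
      P-indep : ∀ i j → i ≢ j → Indep Δ₂ (P i) (P j)
      P-indep F.zero F.zero 0≢0 = ⊥-elim (0≢0 refl)
      P-indep F.zero (F.suc F.zero) _ = ind
      P-indep (F.suc F.zero) F.zero _ = Indep-sym ind
      P-indep (F.suc F.zero) (F.suc F.zero) 1≢1 = ⊥-elim (1≢1 refl)
      partition : ∀ e → ((A ∪ B) e → ∃[ i ] P i e) × (∀ i → P i e → (A ∪ B) e)
      partition e = [ (F.zero ,_) , (F.suc F.zero ,_) ]′ , λ { F.zero → inj₁ ; (F.suc F.zero) → inj₂ }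

  TemplIndep? : ∀ {X Y : Fin n → Set} → Decidable X → Decidable Y → ∀ a b c d →
    Dec (TemplIndep Δ₂ X a b Y c d)
  TemplIndep? {X} {Y} X? Y? a b c d = disjoint? ⊎-dec far?
    where
      disjoint? : Dec (∀ v → X v → Y v → ⊥)
      disjoint? = map′ (λ h v Xv Yv → h v (Xv , Yv)) (λ h v (Xv , Yv) → h v Xv Yv)
                       (all? λ v → ¬? (X? v ×-dec Y? v))
      far? : Dec (∀ s t → a ≤ s → s ≤ b → c ≤ t → t ≤ d → Δ₂ ≤ ∣ s - t ∣)
      far? = map′ (λ h s t a≤s s≤b c≤t t≤d → h s s≤b a≤s t t≤d c≤t)
                  (λ h s s≤b a≤s t t≤d c≤t → h s t a≤s s≤b c≤t t≤d)
                  (∀≤? (λ s → a ≤? s →-dec ∀≤? (λ t → c ≤? t →-dec Δ₂ ≤? ∣ s - t ∣) d) b)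

  VS? : (C : List (TimeEdge n)) → Decidable (VS (_∈ C))
  VS? C v = map′ find (λ (_ , e∈C , ve) → lose e∈C ve) (Any.any? (Ends? v) C)

  Indep? : (C D : List (TimeEdge n)) → Dec (Indep Δ₂ (_∈ C) (_∈ D))
  Indep? [] _ = yes λ { _ _ _ _ ((_ , () , _) , _) _ }
  Indep? (_ ∷ _) [] = yes λ { _ _ _ _ _ ((_ , () , _) , _) }
  Indep? C@(c ∷ _) D@(d ∷ _)
    with span-of-enumerated (id , id) (c , here refl) | span-of-enumerated (id , id) (d , here refl)
  ... | a , b , spC | c′ , d′ , spD =
    map′ (Indep-via-span spC spD) (λ ind → ind _ _ _ _ spC spD) (TemplIndep? (VS? C) (VS? D) a b c′ d′)

module TimeEdgeSets (Δ₂ : ℕ) (1≤Δ₂ : 1 ≤ Δ₂) {n : ℕ} (G : TGraph n) where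

  open Independence Δ₂

  ℰ : TESet n
  ℰ = IsTE G

  ℰ? : Decidable ℰ
  ℰ? (x , y , t) = x F.<? y ×-dec at G x y t ≟ᵇ true

  canonical : ∀ {x y t} → at G x y t ≡ true → ∃[ f ] (ℰ f × Ends x f × Ends y f × time f ≡ t)
  canonical {x} {y} {t} xyt with Fin-<-cmp x y
  ... | tri< x<y _ _ = (x , y , t) , (x<y , xyt) , inj₁ refl , inj₂ refl , refl
  ... | tri> _ _ y<x = (y , x , t) , (y<x , trans (TGraph.sym G y x t) xyt) , inj₂ refl , inj₁ refl , refl
  ... | tri≈ _ refl _ with trans (sym xyt) (irrefl G x t)
  ...   | ()

  label-bound : ∀ {x y t} → at G x y t ≡ true → t ≤ proj₁ (bounded G)
  label-bound {x} {y} {t} xyt with t ≤? proj₁ (bounded G)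
  ... | yes t≤L = t≤L
  ... | no t≰L with trans (sym xyt) (proj₂ (bounded G) x y t (≰⇒> t≰L))
  ...   | ()

  span-within-lifetime : ∀ {A a b} → A ⊆ ℰ → Span A a b → 1 ≤ a × (∀ L → IsLifetime G L → b ≤ L)
  span-within-lifetime A⊆ℰ ((e , Ae , refl) , (f , Af , refl) , _) =
    label-positive (A⊆ℰ Ae) , λ L (_ , maximal) → maximal _ _ _ (A⊆ℰ Af .proj₂)
    where
      label-positive : ∀ {e} → ℰ e → 1 ≤ time e
      label-positive {x , y , zero} (_ , xy0) with trans (sym xy0) (pos G x y)
      ... | ()
      label-positive {_ , _ , suc _} _ = s≤s z≤n

  candidates : List (TimeEdge n)
  candidates = cartesianProduct (allFin n) (cartesianProduct (allFin n) (upTo (suc (proj₁ (bounded G)))))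

  ℰ-list : List (TimeEdge n)
  ℰ-list = filter ℰ? candidates

  ℰ-list-enumerates : ℰ-list enumerates ℰ
  ℰ-list-enumerates =
    (λ e∈ → proj₂ (∈-filter⁻ ℰ? {xs = candidates} e∈)) ,
    λ { e@(_ , xyt) → ∈-filter⁺ ℰ? (∈-cartesianProduct⁺ (∈-allFin _)
                        (∈-cartesianProduct⁺ (∈-allFin _) (∈-upTo⁺ (s≤s (label-bound xyt))))) e }

  ¬¬-span : ∀ {A} → A ⊆ ℰ → ¬ ¬ (Nonempty A → SpanOf A)
  ¬¬-span A⊆ℰ = ¬¬-map (λ (_ , ys≅) → span-of-enumerated ys≅)
                        (¬¬-enumerable _ ℰ-list (ℰ-list-enumerates .proj₂ ∘ A⊆ℰ))

  Indep⇒¬near : ∀ {A B : TESet n} {e f v} → A ⊆ ℰ → B ⊆ ℰ → Indep Δ₂ A B → A e → B f →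
    Ends v e → Ends v f → ∣ time e - time f ∣ < Δ₂ → ⊥
  Indep⇒¬near A⊆ℰ B⊆ℰ ind Ae Bf ve vf near =
    ¬¬-span A⊆ℰ λ spanA → ¬¬-span B⊆ℰ λ spanB →
    <⇒≱ near (Indep⇒far ind (spanA (_ , Ae) .proj₂ .proj₂) (spanB (_ , Bf) .proj₂ .proj₂) Ae Bf ve vf)

  Indep⇒disjoint : ∀ {A B : TESet n} {e} → A ⊆ ℰ → B ⊆ ℰ → Indep Δ₂ A B → A e → B e → ⊥
  Indep⇒disjoint {e = e} A⊆ℰ B⊆ℰ ind Ae Be =
    Indep⇒¬near A⊆ℰ B⊆ℰ ind Ae Be (inj₁ refl) (inj₁ refl) (subst (_< Δ₂) (sym (∣n-n∣≡0 (time e))) 1≤Δ₂)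

  record IndepFamily : Set₁ where
    field
      size    : ℕ
      piece   : Fin size → TESet n
      piece⊆ℰ : ∀ i → piece i ⊆ ℰ
      indep   : ∀ i j → i ≢ j → Indep Δ₂ (piece i) (piece j)

    Covers : TESet n → Set
    Covers U = ∀ {e} → U e → ∃[ i ] piece i e

  open IndepFamily

  indivisible-if-⊆piece : ∀ {U} → U ⊆ ℰ →
    (∀ F → Covers F U → ¬ ¬ (∃[ j ] U ⊆ piece F j)) → Indivisible Δ₂ U
  indivisible-if-⊆piece U⊆ℰ ⊆piece (k , 2≤k , P , nonempty , P-indep , partition) =
    ⊆piece F (λ Ue → partition _ .proj₁ Ue) λ (j , U⊆Pj) →
      let l , l≢j = other 2≤k j
          h , Plh = nonempty l
      in Indep⇒disjoint (P⊆ℰ j) (P⊆ℰ l) (P-indep j l (l≢j ∘ sym)) (U⊆Pj (partition h .proj₂ l Plh)) Plh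
    where
      P⊆ℰ : ∀ i → P i ⊆ ℰ
      P⊆ℰ i Pie = U⊆ℰ (partition _ .proj₂ i Pie)
      F : IndepFamily
      F = record { size = k ; piece = P ; piece⊆ℰ = P⊆ℰ ; indep = P-indep }

  module _ {S : TESet n} (indiv : Indivisible Δ₂ S) (F : IndepFamily) (S⊆⋃F : Covers F S) where

    Meets : Fin (size F) → Set
    Meets j = Nonempty (S ∩ piece F j)

    covered : ∀ {m} (sel : Selection Meets m) {e} → S e → ∃[ i ] (S ∩ piece F (Selection.enum sel i)) e
    covered sel Se with S⊆⋃F Se
    ... | j , Pje with Selection.complete sel j (_ , Se , Pje)
    ...   | i , refl = i , Se , Pje

    ⊆piece : ∀ {m} → Selection Meets m → (∀ j → Nonempty (piece F j) → SpanOf (piece F j)) →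
      Nonempty S → ∃[ j ] S ⊆ piece F j
    ⊆piece {zero} sel _ (_ , Se₀) with covered sel Se₀
    ... | () , _
    ⊆piece {suc zero} sel _ _ = enum F.zero , λ Se → only-piece (covered sel Se)
      where
        open Selection sel
        only-piece : ∀ {e} → ∃[ i ] (S ∩ piece F (enum i)) e → piece F (enum F.zero) e
        only-piece (F.zero , _ , Pe) = Pe
    ⊆piece {suc (suc m)} sel span _ =
      ⊥-elim (indiv (suc (suc m) , s≤s (s≤s z≤n) , Q , sound , Q-indep , λ _ → covered sel , λ _ → proj₁))
      where
        open Selection sel
        Q : Fin (suc (suc m)) → TESet n
        Q i = S ∩ piece F (enum i)
        span-of : ∀ i → Span (piece F (enum i)) _ _
        span-of i = let e , _ , Pe = sound i in span _ (e , Pe) .proj₂ .proj₂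
        Q-indep : ∀ i i′ → i ≢ i′ → Indep Δ₂ (Q i) (Q i′)
        Q-indep i i′ i≢i′ = Indep-mono proj₂ proj₂ (span-of i) (span-of i′) (indep F _ _ (i≢i′ ∘ injective))

    Indivisible⇒⊆piece : Nonempty S → ¬ ¬ (∃[ j ] S ⊆ piece F j)
    Indivisible⇒⊆piece S≠∅ = do
      meets? ← ¬¬-∀-Fin λ _ → ¬¬-excluded-middle
      span ← ¬¬-∀-Fin λ j → ¬¬-span (piece⊆ℰ F j)
      pure (⊆piece (select meets? .proj₂) span S≠∅)

  near⇒same-piece : ∀ F {i j e f v} → piece F i e → piece F j f →
    Ends v e → Ends v f → ∣ time e - time f ∣ < Δ₂ → i ≡ j
  near⇒same-piece F {i} {j} Pie Pjf ve vf near = decidable-stable (i F.≟ j) λ i≢j →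
    Indep⇒¬near (piece⊆ℰ F i) (piece⊆ℰ F j) (indep F i j i≢j) Pie Pjf ve vf near

  dependent⇒same-piece : ∀ F {A B i j} → Nonempty A → Nonempty B → A ⊆ piece F i → B ⊆ piece F j →
    ¬ Indep Δ₂ A B → i ≡ j
  dependent⇒same-piece F {i = i} {j} (_ , Ae) (_ , Bf) A⊆Pi B⊆Pj dep = decidable-stable (i F.≟ j) λ i≢j →
    ¬¬-span (piece⊆ℰ F i) λ span-i → ¬¬-span (piece⊆ℰ F j) λ span-j →
    dep (Indep-mono A⊆Pi B⊆Pj (span-i (_ , A⊆Pi Ae) .proj₂ .proj₂) (span-j (_ , B⊆Pj Bf) .proj₂ .proj₂)
                    (indep F i j i≢j))

  indivisible-singleton : ∀ {e} → ℰ e → Indivisible Δ₂ (_∈ [ e ])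
  indivisible-singleton ℰe = indivisible-if-⊆piece (λ { (here refl) → ℰe }) λ F cover →
    let j , Pje = cover (here refl) in pure (j , λ { {_} (here refl) → Pje })

  indivisible-merge : ∀ {U A B} → A ⊆ ℰ → B ⊆ ℰ → U ⊆ A ∪ B → A ⊆ U → B ⊆ U →
    Nonempty A → Nonempty B → Indivisible Δ₂ A → Indivisible Δ₂ B → ¬ Indep Δ₂ A B → Indivisible Δ₂ U
  indivisible-merge {U} {A} {B} A⊆ℰ B⊆ℰ U⊆A∪B A⊆U B⊆U A≠∅ B≠∅ indivA indivB dep =
    indivisible-if-⊆piece (λ Ue → [ A⊆ℰ , B⊆ℰ ]′ (U⊆A∪B Ue)) λ F cover → do
      i , A⊆Pi ← Indivisible⇒⊆piece indivA F (λ Ae → cover (A⊆U Ae)) A≠∅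
      j , B⊆Pj ← Indivisible⇒⊆piece indivB F (λ Be → cover (B⊆U Be)) B≠∅
      let B⊆Pi = subst (λ l → B ⊆ piece F l) (sym (dependent⇒same-piece F A≠∅ B≠∅ A⊆Pi B⊆Pj dep)) B⊆Pj
      pure (i , λ {_} Ue → [ A⊆Pi , B⊆Pi ]′ (U⊆A∪B Ue))

  saturated-closed : ∀ {S g f v} → Saturated G Δ₂ S → S g → ℰ f → Ends v g → Ends v f →
    ∣ time g - time f ∣ < Δ₂ → ¬ ¬ S f
  saturated-closed {S} {g} {f} (S⊆ℰ , indiv , maximal) Sg ℰf vg vf near ¬Sf =
    maximal f ℰf ¬Sf (indivisible-if-⊆piece (λ { (inj₁ Se) → S⊆ℰ _ Se ; (inj₂ refl) → ℰf }) λ F cover → do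
      j , S⊆Pj ← Indivisible⇒⊆piece indiv F (λ Se → cover (inj₁ Se)) (g , Sg)
      let l , Plf = cover (inj₂ refl)
          Pjf = subst (λ i → piece F i f) (sym (near⇒same-piece F (S⊆Pj Sg) Plf vg vf near)) Plf
      pure (j , λ { {_} (inj₁ Se) → S⊆Pj Se ; {_} (inj₂ refl) → Pjf }))

  Class : Set
  Class = List (TimeEdge n)

  Independent : Class → Class → Set
  Independent C D = Indep Δ₂ (_∈ C) (_∈ D)

  Good : Class → Set₁
  Good C = Nonempty (_∈ C) × Indivisible Δ₂ (_∈ C) × (_∈ C) ⊆ ℰ

  Good-++ : ∀ {C D} → Good C → Good D → ¬ Independent C D → Good (C ++ D)
  Good-++ {C} {D} (C≠∅ , indivC , C⊆ℰ) (D≠∅ , indivD , D⊆ℰ) dep =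
    (C≠∅ .proj₁ , ∈-++⁺ˡ (C≠∅ .proj₂)) ,
    indivisible-merge C⊆ℰ D⊆ℰ (∈-++⁻ C) ∈-++⁺ˡ (∈-++⁺ʳ C) C≠∅ D≠∅ indivC indivD dep ,
    λ e∈C++D → [ C⊆ℰ , D⊆ℰ ]′ (∈-++⁻ C e∈C++D)

  record GoodCover (Cs : List Class) : Set₁ where
    field
      good   : ∀ {C} → C ∈ Cs → Good C
      covers : ∀ {e} → ℰ e → ∃[ C ] (C ∈ Cs × e ∈ C)

  dependent-of? : ∀ C Ds → (∃₂ λ D Rs → (Ds ↭ D ∷ Rs) × ¬ Independent C D) ⊎ All (Independent C) Ds
  dependent-of? C [] = inj₂ []
  dependent-of? C (D ∷ Ds) with Indep? C D
  ... | no dep = inj₁ (D , Ds , ↭-refl , dep)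
  ... | yes ind with dependent-of? C Ds
  ...   | inj₁ (D′ , Rs , p , dep) = inj₁ (D′ , D ∷ Rs , ↭-trans (↭-prep D p) (↭-swap D D′ ↭-refl) , dep)
  ...   | inj₂ inds = inj₂ (ind ∷ inds)

  dependent-pair? : ∀ Cs →
    (∃₂ λ C D → ∃[ Rs ] (Cs ↭ C ∷ D ∷ Rs) × ¬ Independent C D) ⊎ AllPairs Independent Cs
  dependent-pair? [] = inj₂ []
  dependent-pair? (C ∷ Cs) with dependent-of? C Cs
  ... | inj₁ (D , Rs , p , dep) = inj₁ (C , D , Rs , ↭-prep C p , dep)
  ... | inj₂ inds with dependent-pair? Cs
  ...   | inj₂ pairs = inj₂ (inds ∷ pairs)
  ...   | inj₁ (C′ , D′ , Rs , p , dep) = inj₁ (C′ , D′ , C ∷ Rs ,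
          ↭-trans (↭-prep C p) (↭-trans (↭-swap C C′ ↭-refl) (↭-prep C′ (↭-swap C D′ ↭-refl))) , dep)

  merge-preserves : ∀ {Cs C D Rs} → Cs ↭ C ∷ D ∷ Rs → ¬ Independent C D →
    GoodCover Cs → GoodCover ((C ++ D) ∷ Rs)
  merge-preserves {C = C} {D} {Rs} p dep gc = record { good = good′ ; covers = covers′ }
    where
      open GoodCover gc
      good-CDRs : ∀ {E} → E ∈ C ∷ D ∷ Rs → Good E
      good-CDRs E∈ = good (∈-resp-↭ (↭-sym p) E∈)
      good′ : ∀ {E} → E ∈ (C ++ D) ∷ Rs → Good E
      good′ (here refl) = Good-++ (good-CDRs (here refl)) (good-CDRs (there (here refl))) dep
      good′ (there E∈Rs) = good-CDRs (there (there E∈Rs))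
      covers′ : ∀ {e} → ℰ e → ∃[ E ] (E ∈ (C ++ D) ∷ Rs × e ∈ E)
      covers′ ℰe with covers ℰe
      ... | E , E∈Cs , e∈E with ∈-resp-↭ p E∈Cs
      ...   | here refl = C ++ D , here refl , ∈-++⁺ˡ e∈E
      ...   | there (here refl) = C ++ D , here refl , ∈-++⁺ʳ C e∈E
      ...   | there (there E∈Rs) = E , there E∈Rs , e∈E

  -- Every merge shortens the list of classes, so fuel = length Cs suffices.
  merge-dependent : ∀ fuel Cs → length Cs ≤ fuel → GoodCover Cs →
    ∃[ Ds ] (GoodCover Ds × AllPairs Independent Ds)
  merge-dependent fuel Cs len gc with dependent-pair? Cs
  ... | inj₂ pairs = Cs , gc , pairs
  merge-dependent (suc fuel) Cs len gc | inj₁ (C , D , Rs , p , dep) =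
    merge-dependent fuel ((C ++ D) ∷ Rs) (≤-pred (subst (_≤ suc fuel) (↭-length p) len))
      (merge-preserves p dep gc)
  merge-dependent zero Cs len gc | inj₁ (_ , _ , _ , p , _) with subst (_≤ 0) (↭-length p) len
  ... | ()

  singletons : GoodCover (map [_] ℰ-list)
  singletons = record
    { good = good ; covers = λ ℰe → _ , ∈-map⁺ [_] (ℰ-list-enumerates .proj₂ ℰe) , here refl }
    where
      good : ∀ {C} → C ∈ map [_] ℰ-list → Good C
      good C∈ with ∈-map⁻ [_] C∈
      ... | _ , e∈ , refl = (_ , here refl) , indivisible-singleton ℰe , λ { (here refl) → ℰe }
        where
          ℰe : ℰ _
          ℰe = ℰ-list-enumerates .proj₁ e∈

  independent-cover : ∃[ Cs ] (GoodCover Cs × AllPairs Independent Cs)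
  independent-cover = merge-dependent _ (map [_] ℰ-list) ≤-refl singletons
module Characterisation (Δ₁ Δ₂ : ℕ) (1≤Δ₁ : 1 ≤ Δ₁) (Δ₁<Δ₂ : Δ₁ < Δ₂) {n : ℕ} (G : TGraph n) where

  open Independence Δ₂
  open TimeEdgeSets Δ₂ (≤-trans 1≤Δ₁ (<⇒≤ Δ₁<Δ₂)) G
  open IndepFamily

  Window : Fin n → Fin n → ℕ → Set
  Window x y τ = ∃[ t ] (τ ≤ t × t ≤ τ + Δ₁ ∸ 1 × at G x y t ≡ true)

  Window? : ∀ x y τ → Dec (Window x y τ)
  Window? x y τ = map′
    (λ (t , t≤ , τ≤t , xyt) → t , τ≤t , t≤ , xyt)
    (λ (t , τ≤t , t≤ , xyt) → t , t≤ , τ≤t , xyt)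
    (∃≤? (λ t → τ ≤? t ×-dec at G x y t ≟ᵇ true) (τ + Δ₁ ∸ 1))

  module Templates {k} {X : Fin k → Subset n} {a b : Fin k → ℕ} (realises : Realises G Δ₁ Δ₂ k X a b) where

    InTemplate : Fin k → TESet n
    InTemplate i e = ℰ e × proj₁ e ∈ˢ X i × proj₁ (proj₂ e) ∈ˢ X i × a i ≤ time e × time e ≤ b i

    VS-InTemplate : ∀ {i} → VS (InTemplate i) ⊆ (_∈ˢ X i)
    VS-InTemplate (_ , (_ , x∈ , _) , inj₁ refl) = x∈
    VS-InTemplate (_ , (_ , _ , y∈ , _) , inj₂ refl) = y∈

    span-⊆-template : ∀ {A i c d} → A ⊆ InTemplate i → Span A c d → a i ≤ c × d ≤ b i
    span-⊆-template A⊆Ti ((_ , Ae , refl) , (_ , Af , refl) , _) =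
      A⊆Ti Ae .proj₂ .proj₂ .proj₂ .proj₁ , A⊆Ti Af .proj₂ .proj₂ .proj₂ .proj₂

    templates : IndepFamily
    templates = record { size = k ; piece = InTemplate ; piece⊆ℰ = λ _ → proj₁ ; indep = templates-indep }
      where
        templates-indep : ∀ i j → i ≢ j → Indep Δ₂ (InTemplate i) (InTemplate j)
        templates-indep i j i≢j _ _ _ _ spi spj =
          let ai≤ , ≤bi = span-⊆-template id spi
              aj≤ , ≤bj = span-⊆-template id spj
          in TemplIndep-mono VS-InTemplate VS-InTemplate ai≤ ≤bi aj≤ ≤bj (realises .proj₁ i j i≢j)

    templates-cover : ∀ {S} → (∀ e → S e → ℰ e) → Covers templates S
    templates-cover S⊆ℰ Se with S⊆ℰ _ Se
    ... | ℰe@(_ , xyt) = let i , x∈ , y∈ , ai≤ , ≤bi = realises .proj₂ .proj₂ .proj₁ _ _ _ xyt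
                         in i , ℰe , x∈ , y∈ , ai≤ , ≤bi

    module _ {S i a₀ b₀ x y} (sat : Saturated G Δ₂ S) (S⊆Ti : S ⊆ InTemplate i) (sp : Span S a₀ b₀)
             (x≢y : x ≢ y) (Vx : VS S x) (Vy : VS S y) where

      private
        μ : ℕ
        μ = a i ⊔ (b i + 1 ∸ Δ₁)

        ai≤a₀ : a i ≤ a₀
        ai≤a₀ = span-⊆-template S⊆Ti sp .proj₁

        b₀≤bi : b₀ ≤ b i
        b₀≤bi = span-⊆-template S⊆Ti sp .proj₂

        dense : Dense G Δ₁ x y (a i) (b i)
        dense = realises .proj₂ .proj₂ .proj₂ i x y x≢y
          (VS-InTemplate (VS-mono S⊆Ti Vx)) (VS-InTemplate (VS-mono S⊆Ti Vy))

        S-within-window : ∀ {e} → μ < a₀ → S e → μ ≤ time e × time e < μ + Δ₁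
        S-within-window μ<a₀ Se =
          ≤-trans (<⇒≤ μ<a₀) (span-bounds sp Se .proj₁) ,
          ≤-<-trans (≤-trans (span-bounds sp Se .proj₂) b₀≤bi) (<⊔∸+ (a i) (b i) Δ₁)

        late-label-after-a₀ : ∀ {t ex} → S ex → Ends x ex → μ < a₀ → μ ≤ t → t ≤ μ + Δ₁ ∸ 1 →
          at G x y t ≡ true → ¬ ¬ (a₀ ≤ t)
        late-label-after-a₀ {ex = ex} Sex xex μ<a₀ μ≤t t≤ xyt with canonical xyt
        ... | f , ℰf , xf , _ , refl =
          ¬¬-map (λ Sf → span-bounds sp Sf .proj₁) (saturated-closed sat Sex ℰf xex xf near)
          where
            t<μ+Δ₁ : time f < μ + Δ₁
            t<μ+Δ₁ = ≤∸1⇒< (≤-trans 1≤Δ₁ (m≤n+m Δ₁ μ)) t≤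
            near : ∣ time ex - time f ∣ < Δ₂
            near = <-trans (∣-∣<-window μ (time ex) (time f) Δ₁ (S-within-window μ<a₀ Sex .proj₁)
                                        (S-within-window μ<a₀ Sex .proj₂) μ≤t t<μ+Δ₁)
                           Δ₁<Δ₂

        window-late : ∀ {τ} → μ < τ → τ ≤ a₀ ⊔ (b₀ + 1 ∸ Δ₁) → ¬ ¬ Window x y τ
        window-late {τ} μ<τ τ≤ with dense μ (m≤m⊔n _ _) ≤-refl
        ... | t , μ≤t , t≤ , xyt = ¬¬-map
          (λ a₀≤t → t , ≤-trans τ≤a₀ a₀≤t , ≤-trans t≤ (∸-monoˡ-≤ 1 (+-monoˡ-≤ Δ₁ (<⇒≤ μ<τ))) , xyt)
          (late-label-after-a₀ (Vx .proj₂ .proj₁) (Vx .proj₂ .proj₂) (<-≤-trans μ<τ τ≤a₀) μ≤t t≤ xyt)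
          where
            τ≤a₀ : τ ≤ a₀
            τ≤a₀ = ≤⊔-<⇒≤ τ≤ (≤-<-trans (∸-monoˡ-≤ Δ₁ (+-monoˡ-≤ 1 b₀≤bi))
                                       (≤-<-trans (m≤n⊔m (a i) _) μ<τ))

      window-in-template : ∀ {τ} → a₀ ≤ τ → τ ≤ a₀ ⊔ (b₀ + 1 ∸ Δ₁) → ¬ ¬ Window x y τ
      window-in-template {τ} a₀≤τ τ≤ with τ ≤? μ
      ... | yes τ≤μ = pure (dense τ (≤-trans ai≤a₀ a₀≤τ) τ≤μ)
      ... | no τ≰μ = window-late (≰⇒> τ≰μ) τ≤

  cluster⇒clique : Cluster G Δ₁ Δ₂ → ∀ S → Saturated G Δ₂ S → Clique G Δ₁ S
  cluster⇒clique (_ , _ , _ , _ , realises) S sat a₀ b₀ sp x y x≢y Vx Vy τ a₀≤τ τ≤ =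
    decidable-stable (Window? x y τ) do
      i , S⊆Ti ← Indivisible⇒⊆piece (sat .proj₂ .proj₁) templates (templates-cover (sat .proj₁))
                   (_ , sp .proj₁ .proj₂ .proj₁)
      window-in-template sat S⊆Ti sp x≢y Vx Vy a₀≤τ τ≤
    where open Templates realises

  module FromCover {Cs} (gc : GoodCover Cs) (pairs : AllPairs Independent Cs)
                   (clique : ∀ S → Saturated G Δ₂ S → Clique G Δ₁ S) where

    open GoodCover gc

    class : Fin (length Cs) → Class
    class = lookup Cs

    class-good : ∀ i → Good (class i)
    class-good i = good (∈-lookup i)

    class-of : ∀ {e} → ℰ e → ∃[ j ] e ∈ class j
    class-of ℰe with covers ℰe
    ... | C , C∈Cs , e∈C = Any.index C∈Cs , subst (_ ∈_) (lookup-index C∈Cs) e∈C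

    class-indep : ∀ i j → i ≢ j → Independent (class i) (class j)
    class-indep = lookup-AllPairs Indep-sym pairs

    a b : Fin (length Cs) → ℕ
    a i = span-of-enumerated (id , id) (class-good i .proj₁) .proj₁
    b i = span-of-enumerated (id , id) (class-good i .proj₁) .proj₂ .proj₁

    class-span : ∀ i → Span (_∈ class i) (a i) (b i)
    class-span i = span-of-enumerated (id , id) (class-good i .proj₁) .proj₂ .proj₂

    X : Fin (length Cs) → Subset n
    X i = toSubset (VS? (class i))

    class-saturated : ∀ i → Saturated G Δ₂ (_∈ class i)
    class-saturated i with class-good i
    ... | C≠∅ , indiv , C⊆ℰ = (λ _ → C⊆ℰ) , indiv , maximal
      where
        maximal : ∀ e → ℰ e → ¬ e ∈ class i → ¬ Indivisible Δ₂ ((_∈ class i) ∪｛ e ｝)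
        maximal e ℰe e∉Ci with class-of ℰe
        ... | j , e∈Cj = Indep⇒¬indivisible-∪ C≠∅ (e , refl)
          (Indep-mono id (λ { refl → e∈Cj }) (class-span i) (class-span j) (class-indep i j i≢j))
          where
            i≢j : i ≢ j
            i≢j refl = e∉Ci e∈Cj

    realises : Realises G Δ₁ Δ₂ (length Cs) X a b
    realises = templates-indep , bounds , templates-cover , templates-dense
      where
        templates-indep : ∀ i j → i ≢ j → TemplIndep Δ₂ (_∈ˢ X i) (a i) (b i) (_∈ˢ X j) (a j) (b j)
        templates-indep i j i≢j =
          TemplIndep-mono (∈-toSubset⁻ (VS? _)) (∈-toSubset⁻ (VS? _)) ≤-refl ≤-refl ≤-refl ≤-refl
            (class-indep i j i≢j _ _ _ _ (class-span i) (class-span j))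
        bounds : ∀ i → 1 ≤ a i × a i ≤ b i × (∀ L → IsLifetime G L → b i ≤ L)
        bounds i = let 1≤a , b≤L = span-within-lifetime (class-good i .proj₂ .proj₂) (class-span i)
                   in 1≤a , Span-≤ (class-span i) , b≤L
        templates-cover : ∀ x y t → at G x y t ≡ true → ∃[ i ] (x ∈ˢ X i × y ∈ˢ X i × a i ≤ t × t ≤ b i)
        templates-cover x y t xyt with canonical xyt
        ... | f , ℰf , xf , yf , refl with class-of ℰf
        ...   | j , f∈Cj = j , ∈-toSubset⁺ (VS? _) (f , f∈Cj , xf) , ∈-toSubset⁺ (VS? _) (f , f∈Cj , yf) ,
                          span-bounds (class-span j) f∈Cj
        templates-dense : ∀ i x y → x ≢ y → x ∈ˢ X i → y ∈ˢ X i → Dense G Δ₁ x y (a i) (b i)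
        templates-dense i x y x≢y x∈ y∈ = clique _ (class-saturated i) _ _ (class-span i) x y x≢y
          (∈-toSubset⁻ (VS? _) x∈) (∈-toSubset⁻ (VS? _) y∈)

  clique⇒cluster : (∀ S → Saturated G Δ₂ S → Clique G Δ₁ S) → Cluster G Δ₁ Δ₂
  clique⇒cluster clique with independent-cover
  ... | Cs , gc , pairs = length Cs , X , a , b , realises
    where open FromCover gc pairs clique

lemma6 : (Δ₁ Δ₂ : ℕ) → 1 ≤ Δ₁ → Δ₁ < Δ₂ → (n : ℕ) (G : TGraph n) →
    Cluster G Δ₁ Δ₂ ⇔ (∀ (S : TESet n) → Saturated G Δ₂ S → Clique G Δ₁ S)
lemma6 Δ₁ Δ₂ 1≤Δ₁ Δ₁<Δ₂ n G = mk⇔ cluster⇒clique clique⇒cluster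
  where open Characterisation Δ₁ Δ₂ 1≤Δ₁ Δ₁<Δ₂ G
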